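{- In the setting described in the context (with $U_0$ a recurrent state and $v_1$ following an anti-threshold rule), let $x\in\{+1,-1\}$ and $t\ge0$. If $(c_t,c_{t+1},c_{t+2})=(x,-x,x)$, then $U^*_{t+1}=U^*_{t+3}$.
   Context: $G$ is a finite graph (loops allowed, no multiple edges) on vertex set $\{v_1,\dots,v_n\}$; $N_i$ is the neighbourhood of $v_i$ (including $v_i$ iff there is a loop at $v_i$). Each vertex holds an opinion in $\{+1,-1\}$; $U_t$ is the set of vertices with opinion $+1$ at time $t$. All vertices update simultaneously: $v_i\in U_{t+1}$ iff $N_i\cap U_t\in\mathcal S_i$, where for $i\ge2$, $\mathcal S_i=\{A\subseteq N_i:|A|\ge r_i\}$ (threshold rule, integer $r_i$), and $v_1$ follows an anti-threshold rule: $\mathcal S_1=\{A\subseteq N_1:|A|<r_1\}$ for some integer $r_1$. The initial state is recurrent: $U_p=U_0$ for some $p\ge1$. $c_t\in\{+1,-1\}$ denotes the opinion of $v_1$ at time $t$, and $U^*_t=U_t\setminus\{v_1\}$. -}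

module Defs where

open import Data.Nat using (ℕ; zero; suc)
open import Data.Bool using (Bool; true; false; _∧_; if_then_else_)
open import Data.Fin using (Fin; zero; suc)
open import Data.List using (List; length; filter)
open import Data.List using () renaming (allFin to allFinL)
open import Data.Bool.Properties using (T?)
open import Data.Integer using (ℤ; +_)
open import Data.Integer.Properties using () renaming (_<?_ to _<ℤ?_; _≤?_ to _≤ℤ?_)
open import Relation.Nullary.Decidable using (⌊_⌋)
open import Relation.Binary.PropositionalEquality using (_≡_)
open import Data.Product using (Σ)

-- A finite graph on m vertices (loops allowed, no multiple edges):
-- a symmetric Boolean adjacency relation.  adj i i ≡ true means a loop at i.
record Graph (m : ℕ) : Set where
  field
    adj  : Fin m → Fin m → Bool
    sym  : ∀ i j → adj i j ≡ adj j i

-- A state: the set U of vertices with opinion +1 (true = +1, false = -1).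
State : ℕ → Set
State m = Fin m → Bool

countPlus : ∀ {m} → Graph m → State m → Fin m → ℕ
countPlus G U i = length (filter (λ j → T? (Graph.adj G i j ∧ U j)) (allFinL _))

-- Vertex set {v_1,…,v_n} is Fin (suc n); v_1 is vertex zero.
step : ∀ {n} → Graph (suc n) → (Fin (suc n) → ℤ) → State (suc n) → State (suc n)
step G r U zero    = ⌊ (+ countPlus G U zero) <ℤ? r zero ⌋
step G r U (suc i) = ⌊ r (suc i) ≤ℤ? (+ countPlus G U (suc i)) ⌋

traj : ∀ {n} → Graph (suc n) → (Fin (suc n) → ℤ) → State (suc n) → ℕ → State (suc n)
traj G r U₀ zero    = U₀
traj G r U₀ (suc t) = step G r (traj G r U₀ t)

_≋_ : ∀ {m} → State m → State m → Set
U ≋ V = ∀ i → U i ≡ V i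

Recurrent : ∀ {n} → Graph (suc n) → (Fin (suc n) → ℤ) → State (suc n) → Set
-- (p is written suc p so that p ≥ 1.)
Recurrent G r U₀ = Σ ℕ (λ p → traj G r U₀ (suc p) ≋ U₀)

-- The anti-threshold vertex v₁ acts on the threshold vertices as an external input.  For these,
-- Goles' energy of two consecutive states grows from one step to the next by a sum of local terms,
-- one per vertex; each is nonnegative because v₁ shifts a local field by at most one, and it is
-- positive when the vertex changes its opinion over two steps to the one v₁ did not hold in between.
-- On a cycle the energy comes back to its value, so every threshold vertex that flips over two steps
-- adopts the opinion v₁ held in between.  If v₁ shows x, −x, x at times t, t+1, t+2, this makes U_t
-- and U_{t+2} comparable, so U_{t+1} and U_{t+3} are comparable one way by monotonicity of threshold
-- rules and the other way by the same fact at time t + 1.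
module Submission where

open import Defs
open import Data.Bool using (Bool; true; false; not; _∧_; f≤t; b≤b) renaming (_≤_ to _≤ᵇ_)
open import Data.Bool.Properties using (T?; ≤-minimum; ≤-maximum)
  renaming (≤-reflexive to ≤ᵇ-reflexive; ≤-antisym to ≤ᵇ-antisym)
open import Data.Fin using (Fin; zero; suc)
open import Data.Integer using (ℤ)
open import Data.List using (length; filter; tabulate)
open import Data.Nat using (ℕ; zero; suc)
import Data.Nat as ℕ
import Data.Nat.Properties as ℕ
open import Data.Product using (_,_)
open import Data.Sum using (_⊎_; inj₁; inj₂)
open import Data.Empty using (⊥-elim)
open import Data.Fin using (punchIn)
open import Data.Vec.Functional using (removeAt)
open import Function using (_∘_)
open import Relation.Binary.PropositionalEquality
  using (_≡_; _≢_; _≗_; refl; sym; trans; cong; cong₂; subst; subst₂; module ≡-Reasoning)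
open import Relation.Nullary using (yes; no; contradiction)
open import Relation.Nullary.Decidable using (⌊_⌋)

module IntegerSums where

  open import Data.Integer using (+_; 0ℤ; 1ℤ; _+_; _*_; _≤_; _<_; +≤+)
  open import Data.Integer.Properties
    using (+-*-semiring; ≤-refl; ≤-trans; +-mono-≤; +-mono-<-≤; +-monoʳ-≤; +-monoʳ-<;
           +-identityˡ; +-identityʳ)
  open import Algebra.Properties.Semiring.Sum +-*-semiring public

  ⟦_⟧ : Bool → ℤ
  ⟦ true  ⟧ = 1ℤ
  ⟦ false ⟧ = 0ℤ

  ⟦∧⟧ : ∀ a b → ⟦ a ∧ b ⟧ ≡ ⟦ a ⟧ * ⟦ b ⟧
  ⟦∧⟧ false b     = refl
  ⟦∧⟧ true  false = refl
  ⟦∧⟧ true  true  = refl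

  ⟦∧⟧-monoʳ : ∀ a {b b′} → b ≤ᵇ b′ → ⟦ a ∧ b ⟧ ≤ ⟦ a ∧ b′ ⟧
  ⟦∧⟧-monoʳ false _   = ≤-refl
  ⟦∧⟧-monoʳ true  f≤t = +≤+ ℕ.z≤n
  ⟦∧⟧-monoʳ true  b≤b = ≤-refl

  +length-filter : ∀ {a} {A : Set a} {m} (p : A → Bool) (g : Fin m → A) →
                   + length (filter (T? ∘ p) (tabulate g)) ≡ ∑[ j < m ] ⟦ p (g j) ⟧
  +length-filter {m = zero}  p g = refl
  +length-filter {m = suc m} p g with p (g zero)
  ... | true  = cong (λ s → 1ℤ + s) (+length-filter p (g ∘ suc))
  ... | false = trans (+length-filter p (g ∘ suc)) (sym (+-identityˡ _))

  ∑-mono : ∀ {m} {f g : Fin m → ℤ} → (∀ j → f j ≤ g j) → sum f ≤ sum g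
  ∑-mono {zero}  _   = ≤-refl
  ∑-mono {suc m} f≤g = +-mono-≤ (f≤g zero) (∑-mono (f≤g ∘ suc))

  ∑-nonneg : ∀ {m} {f : Fin m → ℤ} → (∀ j → 0ℤ ≤ f j) → 0ℤ ≤ sum f
  ∑-nonneg {m} {f} 0≤f = subst (_≤ sum f) (sum-replicate-zero m) (∑-mono 0≤f)

  ∑-pos : ∀ {m} {f : Fin m → ℤ} → (∀ j → 0ℤ ≤ f j) → ∀ i → 0ℤ < f i → 0ℤ < sum f
  ∑-pos {suc m} {f} 0≤f i 0<fᵢ =
    subst (0ℤ <_) (sym (sum-remove f))
      (+-mono-<-≤ 0<fᵢ (∑-nonneg {f = removeAt f i} (0≤f ∘ punchIn i)))

  0≤j⇒i≤i+j : ∀ i {j} → 0ℤ ≤ j → i ≤ i + j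
  0≤j⇒i≤i+j i 0≤j = subst (_≤ i + _) (+-identityʳ i) (+-monoʳ-≤ i 0≤j)

  0<j⇒i<i+j : ∀ i {j} → 0ℤ < j → i < i + j
  0<j⇒i<i+j i 0<j = subst (_< i + _) (+-identityʳ i) (+-monoʳ-< i 0<j)

  nondecreasing⇒≤ : (f : ℕ → ℤ) → (∀ s → f s ≤ f (suc s)) → ∀ s → f 0 ≤ f s
  nondecreasing⇒≤ f step zero    = ≤-refl
  nondecreasing⇒≤ f step (suc s) = ≤-trans (nondecreasing⇒≤ f step s) (step s)

module HopfieldEnergy {n : ℕ} (W : Fin n → Fin n → ℤ) (W-sym : ∀ k l → W k l ≡ W l k)
                      (K : Fin n → ℤ) where

  open import Data.Integer using (_+_; _-_; _*_)
  open import Data.Integer.Tactic.RingSolver using (solve-∀)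
  open IntegerSums
  open ≡-Reasoning

  input : (Fin n → ℤ) → Fin n → ℤ
  input y k = ∑[ l < n ] (W k l * y l)

  energy : (Fin n → ℤ) → (Fin n → ℤ) → ℤ
  energy x y = ∑[ k < n ] (x k * input y k + K k * (x k + y k))

  input-sym : ∀ x y → ∑[ k < n ] (x k * input y k) ≡ ∑[ k < n ] (y k * input x k)
  input-sym x y = begin
    ∑[ k < n ] (x k * input y k)
      ≡⟨ sum-cong-≗ (λ k → *-distribˡ-sum (x k) (λ l → W k l * y l)) ⟩
    ∑[ k < n ] ∑[ l < n ] (x k * (W k l * y l))
      ≡⟨ ∑-comm (λ k l → x k * (W k l * y l)) ⟩
    ∑[ l < n ] ∑[ k < n ] (x k * (W k l * y l))
      ≡⟨ sum-cong-≗ (λ l → sum-cong-≗ (λ k → swap k l)) ⟩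
    ∑[ l < n ] ∑[ k < n ] (y l * (W l k * x k))
      ≡⟨ sum-cong-≗ (λ l → *-distribˡ-sum (y l) (λ k → W l k * x k)) ⟨
    ∑[ l < n ] (y l * input x l) ∎
    where
    swap : ∀ k l → x k * (W k l * y l) ≡ y l * (W l k * x k)
    swap k l = trans (exchange (x k) (W k l) (y l)) (cong (λ w → y l * (w * x k)) (W-sym k l))
      where
      exchange : ∀ a w b → a * (w * b) ≡ b * (w * a)
      exchange = solve-∀

  energy-step : ∀ z x y →
    energy x y + ∑[ k < n ] ((z k - y k) * (input x k + K k)) ≡ energy z x
  energy-step z x y = begin
    energy x y + ∑[ k < n ] Δ k
      ≡⟨ cong (_+ ∑[ k < n ] Δ k) (∑-distrib-+ (λ k → x k * input y k) (λ k → K k * (x k + y k))) ⟩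
    (∑[ k < n ] (x k * input y k) + ∑[ k < n ] (K k * (x k + y k))) + ∑[ k < n ] Δ k
      ≡⟨ cong (λ b → (b + ∑[ k < n ] (K k * (x k + y k))) + ∑[ k < n ] Δ k) (input-sym x y) ⟩
    (∑[ k < n ] (y k * input x k) + ∑[ k < n ] (K k * (x k + y k))) + ∑[ k < n ] Δ k
      ≡⟨ cong (_+ ∑[ k < n ] Δ k) (∑-distrib-+ (λ k → y k * input x k) (λ k → K k * (x k + y k))) ⟨
    ∑[ k < n ] (y k * input x k + K k * (x k + y k)) + ∑[ k < n ] Δ k
      ≡⟨ ∑-distrib-+ (λ k → y k * input x k + K k * (x k + y k)) Δ ⟨
    ∑[ k < n ] (y k * input x k + K k * (x k + y k) + Δ k)
      ≡⟨ sum-cong-≗ (λ k → pointwise (z k) (x k) (y k) (input x k) (K k)) ⟩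
    energy z x ∎
    where
    Δ : Fin n → ℤ
    Δ k = (z k - y k) * (input x k + K k)

    pointwise : ∀ z x y h c → y * h + c * (x + y) + (z - y) * (h + c) ≡ z * h + c * (z + x)
    pointwise = solve-∀

  energy-cong : ∀ {x x′ y y′} → x ≗ x′ → y ≗ y′ → energy x y ≡ energy x′ y′
  energy-cong x≗x′ y≗y′ = sum-cong-≗ λ k →
    cong₂ _+_ (cong₂ _*_ (x≗x′ k) (sum-cong-≗ (λ l → cong (W k l *_) (y≗y′ l))))
              (cong (K k *_) (cong₂ _+_ (x≗x′ k) (y≗y′ k)))

module ThresholdRule where

  open import Data.Integer using (+_; 0ℤ; 1ℤ; _+_; _-_; _*_; -_; _≤_; _<_; +≤+; +<+)
  open import Data.Integer.Properties
    using (_≤?_; ≤-refl; ≤-trans; +-mono-≤; +-mono-≤-<; ≰⇒>; i<j⇒suc[i]≤j; i≤j⇒0≤j-i; *-identityˡ; -1*i≡-i)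
  open import Data.Integer.Tactic.RingSolver using (solve-∀)
  open IntegerSums using (⟦_⟧)

  threshold-mono : ∀ r {c c′} → c ≤ c′ → ⌊ r ≤? c ⌋ ≤ᵇ ⌊ r ≤? c′ ⌋
  threshold-mono r {c} {c′} c≤c′ with r ≤? c | r ≤? c′
  ... | yes r≤c | no r≰c′ = contradiction (≤-trans r≤c c≤c′) r≰c′
  ... | yes _   | yes _   = b≤b
  ... | no _    | yes _   = f≤t
  ... | no _    | no _    = b≤b

  -- bias a u = 1 − [a]·(2[u] − 1), so that margin a u c r = 2(c − [a][u] − r) + 1 + [a] does not
  -- depend on the opinion u of v₁ (it only enters through the count c), while its sign follows the
  -- decision ⌊ r ≤? c ⌋ weakly, and strictly when u disagrees with that decision.
  bias : Bool → Bool → ℕ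
  bias false _     = 1
  bias true  true  = 0
  bias true  false = 2

  bias-spec : ∀ a u → ⟦ a ⟧ * ⟦ u ⟧ + ⟦ a ⟧ * ⟦ u ⟧ + + bias a u ≡ 1ℤ + ⟦ a ⟧
  bias-spec false false = refl
  bias-spec false true  = refl
  bias-spec true  false = refl
  bias-spec true  true  = refl

  bias-not : ∀ a u → + 2 - + bias a u ≡ + bias a (not u)
  bias-not false false = refl
  bias-not false true  = refl
  bias-not true  false = refl
  bias-not true  true  = refl

  margin : Bool → Bool → ℤ → ℤ → ℤ
  margin a u c r = (c - r) + (c - r) + + bias a u

  gain : Bool → Bool → ℤ → ℤ
  gain b′ b e = (⟦ b′ ⟧ - ⟦ b ⟧) * e

  twice-plus-nonneg : ∀ {d} m → 0ℤ ≤ d → 0ℤ ≤ d + d + + m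
  twice-plus-nonneg m 0≤d = +-mono-≤ (+-mono-≤ 0≤d 0≤d) (+≤+ ℕ.z≤n)

  twice-plus-pos : ∀ {d} m → 0ℤ ≤ d → 0 ℕ.< m → 0ℤ < d + d + + m
  twice-plus-pos (suc m) 0≤d _ = +-mono-≤-< (+-mono-≤ 0≤d 0≤d) (+<+ (ℕ.s≤s ℕ.z≤n))

  0<bias-false : ∀ a → 0 ℕ.< bias a false
  0<bias-false false = ℕ.s≤s ℕ.z≤n
  0<bias-false true  = ℕ.s≤s ℕ.z≤n

  neg-margin : ∀ a u c r → - margin a u c r ≡ (r - (1ℤ + c)) + (r - (1ℤ + c)) + + bias a (not u)
  neg-margin a u c r =
    trans (flip c r (+ bias a u)) (cong (λ m → (r - (1ℤ + c)) + (r - (1ℤ + c)) + m) (bias-not a u))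
    where
    flip : ∀ c r m → - ((c - r) + (c - r) + m) ≡ (r - (1ℤ + c)) + (r - (1ℤ + c)) + ((1ℤ + 1ℤ) - m)
    flip = solve-∀

  gain-nonneg : ∀ b a u c r → 0ℤ ≤ gain ⌊ r ≤? c ⌋ b (margin a u c r)
  gain-nonneg b a u c r with r ≤? c | b
  ... | yes r≤c | true  = ≤-refl
  ... | yes r≤c | false =
    subst (0ℤ ≤_) (sym (*-identityˡ _)) (twice-plus-nonneg (bias a u) (i≤j⇒0≤j-i r≤c))
  ... | no  r≰c | false = ≤-refl
  ... | no  r≰c | true  =
    subst (0ℤ ≤_) (sym (trans (-1*i≡-i _) (neg-margin a u c r)))
      (twice-plus-nonneg (bias a (not u)) (i≤j⇒0≤j-i (i<j⇒suc[i]≤j (≰⇒> r≰c))))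

  gain-pos : ∀ b a u c r → ⌊ r ≤? c ⌋ ≢ b → ⌊ r ≤? c ⌋ ≢ u → 0ℤ < gain ⌊ r ≤? c ⌋ b (margin a u c r)
  gain-pos b a u c r b′≢b b′≢u with r ≤? c | b | u
  ... | yes r≤c | true  | _     = contradiction refl b′≢b
  ... | yes r≤c | false | true  = contradiction refl b′≢u
  ... | yes r≤c | false | false =
    subst (0ℤ <_) (sym (*-identityˡ _)) (twice-plus-pos (bias a false) (i≤j⇒0≤j-i r≤c) (0<bias-false a))
  ... | no  r≰c | false | _     = contradiction refl b′≢b
  ... | no  r≰c | true  | false = contradiction refl b′≢u
  ... | no  r≰c | true  | true  =
    subst (0ℤ <_) (sym (trans (-1*i≡-i _) (neg-margin a true c r)))
      (twice-plus-pos (bias a false) (i≤j⇒0≤j-i (i<j⇒suc[i]≤j (≰⇒> r≰c))) (0<bias-false a))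

module Dynamics {n : ℕ} (G : Graph (suc n)) (r : Fin (suc n) → ℤ) where

  open import Data.Bool using (_≟_)
  open import Data.Integer using (+_; 0ℤ; 1ℤ; _+_; _-_; _*_; _≤_; _<_; +≤+)
  open import Data.Integer.Properties
    using (_≤?_; _<?_; <-≤-trans; <-irrefl; drop‿+≤+; *-distribʳ-+)
  open import Data.Integer.Tactic.RingSolver using (solve-∀)
  open IntegerSums
  open ThresholdRule
  open Graph G using (adj)
  open ≡-Reasoning

  _⊆_ : State (suc n) → State (suc n) → Set
  U ⊆ V = ∀ j → U j ≤ᵇ V j

  countPlus-sum : ∀ U i → + countPlus G U i ≡ ∑[ j < suc n ] ⟦ adj i j ∧ U j ⟧
  countPlus-sum U i = +length-filter (λ j → adj i j ∧ U j) (λ j → j)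

  countPlus-mono : ∀ {U V} → U ⊆ V → ∀ i → countPlus G U i ℕ.≤ countPlus G V i
  countPlus-mono {U} {V} U⊆V i = drop‿+≤+
    (subst₂ _≤_ (sym (countPlus-sum U i)) (sym (countPlus-sum V i))
      (∑-mono (λ j → ⟦∧⟧-monoʳ (adj i j) (U⊆V j))))

  countPlus-cong : ∀ {U V} → U ≋ V → ∀ i → countPlus G U i ≡ countPlus G V i
  countPlus-cong U≋V i = ℕ.≤-antisym (countPlus-mono (≤ᵇ-reflexive ∘ U≋V) i)
                                     (countPlus-mono (≤ᵇ-reflexive ∘ sym ∘ U≋V) i)

  step-cong : ∀ {U V} → U ≋ V → step G r U ≋ step G r V
  step-cong U≋V zero    = cong (λ c → ⌊ + c <? r zero ⌋) (countPlus-cong U≋V zero)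
  step-cong U≋V (suc i) = cong (λ c → ⌊ r (suc i) ≤? + c ⌋) (countPlus-cong U≋V (suc i))

  step-monoᵗ : ∀ {U V} → U ⊆ V → ∀ i → step G r U (suc i) ≤ᵇ step G r V (suc i)
  step-monoᵗ U⊆V i = threshold-mono (r (suc i)) (+≤+ (countPlus-mono U⊆V (suc i)))

  traj-step : ∀ U s → traj G r (step G r U) s ≡ step G r (traj G r U s)
  traj-step U zero    = refl
  traj-step U (suc s) = cong (step G r) (traj-step U s)

  recurrent-step : ∀ {U} → Recurrent G r U → Recurrent G r (step G r U)
  recurrent-step {U} (p , hp) = p , λ j → trans (cong (λ V → V j) (traj-step U (suc p))) (step-cong hp j)

  recurrent-traj : ∀ {U} → Recurrent G r U → ∀ t → Recurrent G r (traj G r U t)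
  recurrent-traj rec zero    = rec
  recurrent-traj rec (suc t) = recurrent-step (recurrent-traj rec t)

  A : Fin n → Fin n → ℤ
  A k l = ⟦ adj (suc k) (suc l) ⟧

  W : Fin n → Fin n → ℤ
  W k l = A k l + A k l

  W-sym : ∀ k l → W k l ≡ W l k
  W-sym k l = cong (λ a → ⟦ a ⟧ + ⟦ a ⟧) (Graph.sym G (suc k) (suc l))

  K : Fin n → ℤ
  K k = 1ℤ + ⟦ adj (suc k) zero ⟧ - r (suc k) - r (suc k)

  open HopfieldEnergy W W-sym K

  opinions : State (suc n) → Fin n → ℤ
  opinions U k = ⟦ U (suc k) ⟧

  input+K≡margin : ∀ V k → input (opinions V) k + K k ≡
                   margin (adj (suc k) zero) (V zero) (+ countPlus G V (suc k)) (r (suc k))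
  input+K≡margin V k = begin
    input (opinions V) k + K k
      ≡⟨ cong (_+ K k) input≡s+s ⟩
    s + s + K k
      ≡⟨ cong (λ t → s + s + (t - r (suc k) - r (suc k))) (bias-spec a u) ⟨
    s + s + (p + p + + bias a u - r (suc k) - r (suc k))
      ≡⟨ regroup p s (r (suc k)) (+ bias a u) ⟩
    (p + s - r (suc k)) + (p + s - r (suc k)) + + bias a u
      ≡⟨ cong (λ c → (c - r (suc k)) + (c - r (suc k)) + + bias a u) count≡p+s ⟨
    margin a u (+ countPlus G V (suc k)) (r (suc k)) ∎
    where
    a = adj (suc k) zero
    u = V zero
    p = ⟦ a ⟧ * ⟦ u ⟧
    s = ∑[ l < n ] (A k l * opinions V l)

    input≡s+s : input (opinions V) k ≡ s + s
    input≡s+s = trans (sum-cong-≗ (λ l → *-distribʳ-+ (opinions V l) (A k l) (A k l)))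
                      (∑-distrib-+ (λ l → A k l * opinions V l) (λ l → A k l * opinions V l))

    count≡p+s : + countPlus G V (suc k) ≡ p + s
    count≡p+s = trans (countPlus-sum V (suc k))
      (cong₂ _+_ (⟦∧⟧ a u) (sum-cong-≗ (λ l → ⟦∧⟧ (adj (suc k) (suc l)) (V (suc l)))))

    regroup : ∀ p s r m → s + s + (p + p + m - r - r) ≡ (p + s - r) + (p + s - r) + m
    regroup = solve-∀

  Φ : State (suc n) → ℤ
  Φ U = energy (opinions (step G r U)) (opinions U)

  gainAt : State (suc n) → Fin n → ℤ
  gainAt U k = gain (step G r (step G r U) (suc k)) (U (suc k))
                    (margin (adj (suc k) zero) (step G r U zero)
                            (+ countPlus G (step G r U) (suc k)) (r (suc k)))

  gainAt-nonneg : ∀ U k → 0ℤ ≤ gainAt U k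
  gainAt-nonneg U k = gain-nonneg (U (suc k)) (adj (suc k) zero) (step G r U zero)
                                  (+ countPlus G (step G r U) (suc k)) (r (suc k))

  Φ-step : ∀ U → Φ U + ∑[ k < n ] gainAt U k ≡ Φ (step G r U)
  Φ-step U = trans
    (cong (λ S → Φ U + S) (sum-cong-≗ λ k →
      cong (gain (step G r (step G r U) (suc k)) (U (suc k))) (sym (input+K≡margin (step G r U) k))))
    (energy-step (opinions (step G r (step G r U))) (opinions (step G r U)) (opinions U))

  Φ-mono : ∀ U → Φ U ≤ Φ (step G r U)
  Φ-mono U = subst (Φ U ≤_) (Φ-step U) (0≤j⇒i≤i+j (Φ U) (∑-nonneg (gainAt-nonneg U)))

  Φ-recurrent : ∀ {U} → Recurrent G r U → Φ (step G r U) ≤ Φ U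
  Φ-recurrent {U} (p , hp) = subst (Φ (step G r U) ≤_) Φ-periodic
    (nondecreasing⇒≤ (λ s → Φ (traj G r U (suc s))) (λ s → Φ-mono (traj G r U (suc s))) p)
    where
    Φ-periodic : Φ (traj G r U (suc p)) ≡ Φ U
    Φ-periodic = energy-cong (λ k → cong ⟦_⟧ (step-cong hp (suc k))) (λ k → cong ⟦_⟧ (hp (suc k)))

  flip-follows : ∀ {U} → Recurrent G r U → ∀ k →
    step G r (step G r U) (suc k) ≡ U (suc k) ⊎ step G r (step G r U) (suc k) ≡ step G r U zero
  flip-follows {U} rec k
    with step G r (step G r U) (suc k) ≟ U (suc k) | step G r (step G r U) (suc k) ≟ step G r U zero
  ... | yes same | _          = inj₁ same
  ... | no _     | yes follow = inj₂ follow
  ... | no flip  | no ¬follow = ⊥-elim (<-irrefl refl (<-≤-trans Φ-increases (Φ-recurrent rec)))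
    where
    Φ-increases : Φ U < Φ (step G r U)
    Φ-increases = subst (Φ U <_) (Φ-step U) (0<j⇒i<i+j (Φ U)
      (∑-pos (gainAt-nonneg U) k
        (gain-pos (U (suc k)) (adj (suc k) zero) (step G r U zero)
                  (+ countPlus G (step G r U) (suc k)) (r (suc k)) flip ¬follow)))

  follows-false : ∀ {w v c} → w ≡ v ⊎ w ≡ c → c ≡ false → w ≤ᵇ v
  follows-false (inj₁ refl) _    = b≤b
  follows-false (inj₂ refl) refl = ≤-minimum _

  follows-true : ∀ {w v c} → w ≡ v ⊎ w ≡ c → c ≡ true → v ≤ᵇ w
  follows-true (inj₁ refl) _    = b≤b
  follows-true (inj₂ refl) refl = ≤-maximum _

  alternation⇒stable : ∀ {U} → Recurrent G r U → ∀ x →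
    U zero ≡ x → step G r U zero ≡ not x → step G r (step G r U) zero ≡ x →
    ∀ i → step G r U (suc i) ≡ step G r (step G r (step G r U)) (suc i)
  alternation⇒stable {U} rec true c₀ c₁ c₂ i =
    ≤ᵇ-antisym (follows-true (flip-follows (recurrent-step rec) i) c₂) (step-monoᵗ shrinks i)
    where
    shrinks : step G r (step G r U) ⊆ U
    shrinks zero    = ≤ᵇ-reflexive (trans c₂ (sym c₀))
    shrinks (suc k) = follows-false (flip-follows rec k) c₁
  alternation⇒stable {U} rec false c₀ c₁ c₂ i =
    ≤ᵇ-antisym (step-monoᵗ grows i) (follows-false (flip-follows (recurrent-step rec) i) c₂)
    where
    grows : U ⊆ step G r (step G r U)
    grows zero    = ≤ᵇ-reflexive (trans c₀ (sym c₂))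
    grows (suc k) = follows-true (flip-follows rec k) c₁

open import Data.Nat using (_+_)

lemma4 : ∀ {n} (G : Graph (suc n)) (r : Fin (suc n) → ℤ) (U₀ : State (suc n))
         → Recurrent G r U₀
         → (x : Bool) (t : ℕ)
         → traj G r U₀ t zero ≡ x
         → traj G r U₀ (t + 1) zero ≡ not x
         → traj G r U₀ (t + 2) zero ≡ x
         → (i : Fin n) → traj G r U₀ (t + 1) (suc i) ≡ traj G r U₀ (t + 3) (suc i)
lemma4 G r U₀ rec x t c₀ c₁ c₂ i
  rewrite ℕ.+-comm t 1 | ℕ.+-comm t 2 | ℕ.+-comm t 3 =
  Dynamics.alternation⇒stable G r (Dynamics.recurrent-traj G r rec t) x c₀ c₁ c₂ i
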